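{- Let $r \ge 1$ and $k \ge 2$ be integers, and let $p$ be the largest prime with $p \le k$. For $i \in \{1,2,\dots,r\}$ let $S_i(r,k)$ be the $p$-tuple $$S_i(r,k) = (i, i+1, \dots, r, 1, 2, \dots, r, 1, 2, \dots)$$ of length $p$, i.e. the entry in position $j \in \{1,\dots,p\}$ of $S_i(r,k)$ is the unique element of $\{1,\dots,r\}$ congruent to $i+j-1 \pmod r$. Then one can choose $r - \lceil r/p \rceil$ distinct tuples among $S_1(r,k),\dots,S_r(r,k)$ such that the following holds: if $T$ is the sequence obtained by concatenating these chosen tuples in any order, viewed as a coloring of $\{1,2,\dots,|T|\}$ by the colors $\{1,\dots,r\}$ (the $n$-th entry of $T$ being the color of $n$), then every monochromatic arithmetic progression of length $k$ in $T$ has common difference divisible by $p$.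
   Context: A $k$-term monochromatic arithmetic progression in a coloring of $\{1,\dots,N\}$ is a sequence $x_1 < x_2 < \dots < x_k$ in $\{1,\dots,N\}$ with $x_{i+1}-x_i = d$ constant ($d \ge 1$ the common difference) and all $x_i$ having the same color. -}

module Defs where

open import Data.Nat using (ℕ; zero; suc; _+_; _*_; _∸_; _≤_; _<_)
open import Data.Nat.DivMod using (_/_; _%_)
open import Data.List using (List; []; _∷_; map; upTo; concatMap; length)
open import Data.Product using (_×_)
open import Relation.Binary.PropositionalEquality using (_≡_)

-- ⌈ r / p ⌉ (for p ≥ 1; value at p = 0 is irrelevant and set to 0)
ceilDiv : ℕ → ℕ → ℕ
ceilDiv r zero    = 0
ceilDiv r (suc q) = (r + q) / suc q

-- the unique element of {1,…,r} congruent to m mod r (r ≥ 1; r = 0 irrelevant)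
rep : ℕ → ℕ → ℕ
rep zero    m = 0
rep (suc q) m = suc ((m ∸ 1) % suc q)

S : (r p i : ℕ) → List ℕ
S r p i = map (λ j0 → rep r (i + j0)) (upTo p)   -- j0 = j - 1 ∈ {0..p-1}

concatS : (r p : ℕ) → List ℕ → List ℕ
concatS r p L = concatMap (S r p) L

-- n-th entry (1-indexed) of a list; 0 outside {1..length}
at : List ℕ → ℕ → ℕ
at []       _             = 0
at (x ∷ xs) zero          = 0
at (x ∷ xs) (suc zero)    = x
at (x ∷ xs) (suc (suc n)) = at xs (suc n)

MonoAP : List ℕ → (k a d : ℕ) → Set
MonoAP T k a d =
  1 ≤ d × 1 ≤ a × a + (k ∸ 1) * d ≤ length T ×
  (∀ m → m < k → at T (a + m * d) ≡ at T a)

-- Call the tuple S_i anchored when p ∣ i − 1, and choose the r − ⌈r/p⌉ unanchored ones.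
-- Inside S_i the entry at offset j < p has colour c with c − 1 = (i − 1 + j) mod r.
-- Suppose a monochromatic AP of colour c has a common difference d with p ∤ d. Its first
-- p terms lie in distinct residue classes mod p, so one of them sits at an offset
-- j ≡ c − 1 (mod p) of its tuple S_i. Then j ≤ c − 1 < r and i − 1 < r, so the colour
-- equation holds without wrap-around: i − 1 + j = c − 1. Hence i − 1 ≡ 0 (mod p), i.e.
-- S_i is anchored, which is impossible.
module Submission where

open import Defs
open import Data.Nat using (ℕ; zero; suc; _+_; _*_; _∸_; _≤_; _<_; z≤n; s≤s; s≤s⁻¹; NonZero; ≢-nonZero⁻¹)
open import Data.Nat.Properties
open import Data.Nat.DivMod
open import Data.Nat.Divisibility
open import Data.Nat.Primality using (Prime; euclidsLemma; prime⇒nonZero)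
open import Data.Fin using (Fin; toℕ; fromℕ<; punchOut)
open import Data.Fin.Properties using (any?; toℕ<n; toℕ-injective; toℕ-fromℕ<; punchOut-injective; injective⇒≤)
open import Data.List using (List; []; _∷_; length; _++_; applyUpTo; upTo; concatMap)
open import Data.List.Properties using (length-map; length-upTo; length-++; map-upTo)
open import Data.List.Relation.Unary.All as All using (All; []; _∷_)
open import Data.List.Relation.Unary.Any using (here; there)
open import Data.List.Relation.Unary.AllPairs using ([]; _∷_)
open import Data.List.Relation.Unary.Unique.Propositional using (Unique)
open import Data.List.Membership.Propositional using (_∈_)
open import Data.List.Relation.Binary.Permutation.Propositional using (_↭_; ↭-sym)
open import Data.List.Relation.Binary.Permutation.Propositional.Properties using (All-resp-↭; ∈-resp-↭)
open import Data.Product using (Σ; ∃; _×_; _,_)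
open import Data.Sum using (inj₁; inj₂)
open import Function using (_∘_)
open import Function.Definitions using (Injective)
open import Relation.Nullary using (¬_; yes; no; contradiction)
open import Relation.Binary.PropositionalEquality
open ≡-Reasoning

∣∧<⇒≡0 : ∀ {m n} → m ∣ n → n < m → n ≡ 0
∣∧<⇒≡0 {n = zero}  _   _   = refl
∣∧<⇒≡0 {n = suc _} m∣n n<m = contradiction m∣n (>⇒∤ n<m)

m%o≡[m+n]%o⇒o∣n : ∀ m n {o} .{{_ : NonZero o}} → m % o ≡ (m + n) % o → o ∣ n
m%o≡[m+n]%o⇒o∣n m n {o} eq =
  ∣m+n∣m⇒∣n (divides ((m + n) / o) (+-cancelˡ-≡ (m % o) _ _ decompose)) (n∣m*n (m / o))
  where
  decompose : m % o + (m / o * o + n) ≡ m % o + (m + n) / o * o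
  decompose = begin
    m % o + (m / o * o + n)       ≡⟨ +-assoc (m % o) _ n ⟨
    m % o + m / o * o + n         ≡⟨ cong (_+ n) (m≡m%n+[m/n]*n m o) ⟨
    m + n                         ≡⟨ m≡m%n+[m/n]*n (m + n) o ⟩
    (m + n) % o + (m + n) / o * o ≡⟨ cong (_+ (m + n) / o * o) eq ⟨
    m % o + (m + n) / o * o       ∎

m<o⇒n≤[m+n]%o⇒m+n<o : ∀ {m n o} .{{_ : NonZero o}} → m < o → n ≤ (m + n) % o → m + n < o
m<o⇒n≤[m+n]%o⇒m+n<o {m} {n} {o} m<o n≤[m+n]%o with m + n <? o
... | yes m+n<o = m+n<o
... | no  m+n≮o = contradiction (≤-trans n≤[m+n]%o (≤-reflexive wrapped)) (<⇒≱ excess<n)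
  where
  o≤m+n : o ≤ m + n
  o≤m+n = ≮⇒≥ m+n≮o
  excess<n : m + n ∸ o < n
  excess<n = subst (m + n ∸ o <_) (m+n∸m≡n o n) (∸-monoˡ-< (+-monoˡ-< n m<o) o≤m+n)
  excess<o : m + n ∸ o < o
  excess<o = <-trans excess<n (≤-<-trans n≤[m+n]%o (m%n<n (m + n) o))
  wrapped : (m + n) % o ≡ m + n ∸ o
  wrapped = trans (sym (m≤n⇒[n∸m]%m≡n%m o≤m+n)) (m<n⇒m%n≡m excess<o)

j≡[i+j]%r%p⇒p∣i : ∀ {i j r p} .{{_ : NonZero r}} .{{_ : NonZero p}} →
                             i < r → j ≡ (i + j) % r % p → p ∣ i
j≡[i+j]%r%p⇒p∣i {i} {j} {r} {p} i<r j≡ = m%o≡[m+n]%o⇒o∣n j i (begin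
  j % p           ≡⟨ m<n⇒m%n≡m j<p ⟩
  j               ≡⟨ j≡ ⟩
  (i + j) % r % p ≡⟨ cong (_% p) (m<n⇒m%n≡m (m<o⇒n≤[m+n]%o⇒m+n<o i<r j≤)) ⟩
  (i + j) % p     ≡⟨ cong (_% p) (+-comm i j) ⟩
  (j + i) % p     ∎)
  where
  j<p : j < p
  j<p = subst (_< p) (sym j≡) (m%n<n _ p)
  j≤ : j ≤ (i + j) % r
  j≤ = subst (_≤ (i + j) % r) (sym j≡) (m%n≤m _ p)

module _ {p d : ℕ} (prime-p : Prime p) (p∤d : ¬ p ∣ d) where
  private instance _ = prime⇒nonZero prime-p

  residues-distinct : ∀ A {m₁ m₂} → m₁ ≤ m₂ → m₂ < p →
                      (A + m₁ * d) % p ≡ (A + m₂ * d) % p → m₁ ≡ m₂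
  residues-distinct A {m} m≤ m+t<p eq with t , refl ← m≤n⇒∃[o]m+o≡n m≤ =
    sym (trans (cong (m +_) t≡0) (+-identityʳ m))
    where
    expand : A + (m + t) * d ≡ A + m * d + t * d
    expand = trans (cong (A +_) (*-distribʳ-+ d m t)) (sym (+-assoc A (m * d) (t * d)))
    p∣td : p ∣ t * d
    p∣td = m%o≡[m+n]%o⇒o∣n (A + m * d) (t * d) (trans eq (cong (_% p) expand))
    t≡0 : t ≡ 0
    t≡0 with euclidsLemma t d prime-p p∣td
    ... | inj₁ p∣t = ∣∧<⇒≡0 p∣t (≤-<-trans (m≤n+m t m) m+t<p)
    ... | inj₂ p∣d = contradiction p∣d p∤d

  residue-injective : ∀ A → Injective _≡_ _≡_ (λ (m : Fin p) → (A + toℕ m * d) mod p)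
  residue-injective A {m₁} {m₂} eq with ≤-total (toℕ m₁) (toℕ m₂)
  ... | inj₁ m₁≤m₂ = toℕ-injective (residues-distinct A m₁≤m₂ (toℕ<n m₂) eq′)
    where
    eq′ = trans (sym (toℕ-fromℕ< _)) (trans (cong toℕ eq) (toℕ-fromℕ< _))
  ... | inj₂ m₂≤m₁ = toℕ-injective (sym (residues-distinct A m₂≤m₁ (toℕ<n m₁) eq′))
    where
    eq′ = trans (sym (toℕ-fromℕ< _)) (trans (cong toℕ (sym eq)) (toℕ-fromℕ< _))

injective⇒surjective : ∀ {n} {f : Fin n → Fin n} → Injective _≡_ _≡_ f → ∀ y → ∃ λ x → f x ≡ y
injective⇒surjective {suc n} {f} f-inj y with any? (λ x → f x Data.Fin.≟ y)
... | yes hit  = hit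
... | no  miss = contradiction (injective⇒≤ {f = skip} skip-injective) 1+n≰n
  where
  skip : Fin (suc n) → Fin n
  skip x = punchOut {i = y} {j = f x} (λ y≡fx → miss (x , sym y≡fx))
  skip-injective : Injective _≡_ _≡_ skip
  skip-injective {x₁} {x₂} eq =
    f-inj (punchOut-injective (λ y≡fx → miss (x₁ , sym y≡fx)) (λ y≡fx → miss (x₂ , sym y≡fx)) eq)

residues-cover : ∀ {p d} → Prime p → ¬ p ∣ d → ∀ A j .{{_ : NonZero p}} → j < p →
                 ∃ λ m → m < p × (A + m * d) % p ≡ j
residues-cover {p} {d} prime-p p∤d A j j<p
  with m , hit ← injective⇒surjective (residue-injective prime-p p∤d A) (fromℕ< j<p) =
  toℕ m , toℕ<n m , trans (sym (toℕ-fromℕ< _)) (trans (cong toℕ hit) (toℕ-fromℕ< j<p))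

at-++ˡ : ∀ xs ys {t} → t < length xs → at (xs ++ ys) (suc t) ≡ at xs (suc t)
at-++ˡ (x ∷ xs)     ys {zero}  _         = refl
at-++ˡ (x ∷ y ∷ xs) ys {suc t} (s≤s t<n) = at-++ˡ (y ∷ xs) ys t<n

at-++ʳ : ∀ xs ys t → at (xs ++ ys) (suc (length xs + t)) ≡ at ys (suc t)
at-++ʳ []       ys t = refl
at-++ʳ (x ∷ xs) ys t = at-++ʳ xs ys t

at-applyUpTo : ∀ (f : ℕ → ℕ) {n j} → j < n → at (applyUpTo f n) (suc j) ≡ f j
at-applyUpTo f {suc n} {zero}  _         = refl
at-applyUpTo f {suc n} {suc j} (s≤s j<n) = at-applyUpTo (f ∘ suc) j<n

module _ {p : ℕ} (f : ℕ → List ℕ) (length-f : ∀ i → length (f i) ≡ p) where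

  length-concatMap-uniform : ∀ L → length (concatMap f L) ≡ length L * p
  length-concatMap-uniform []      = refl
  length-concatMap-uniform (i ∷ L) =
    trans (length-++ (f i)) (cong₂ _+_ (length-f i) (length-concatMap-uniform L))

  at-concatMap-uniform : ∀ L {b j} → b < length L → j < p →
    ∃ λ i → i ∈ L × at (concatMap f L) (suc (b * p + j)) ≡ at (f i) (suc j)
  at-concatMap-uniform (i ∷ L) {zero} {j} _ j<p =
    i , here refl , at-++ˡ (f i) _ (subst (j <_) (sym (length-f i)) j<p)
  at-concatMap-uniform (i ∷ L) {suc b} {j} (s≤s b<n) j<p
    with i′ , i′∈L , at≡ ← at-concatMap-uniform L b<n j<p =
    i′ , there i′∈L , (begin
      at (f i ++ concatMap f L) (suc (p + b * p + j))              ≡⟨ cong (at (f i ++ concatMap f L) ∘ suc) shift ⟩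
      at (f i ++ concatMap f L) (suc (length (f i) + (b * p + j))) ≡⟨ at-++ʳ (f i) _ _ ⟩
      at (concatMap f L) (suc (b * p + j))                         ≡⟨ at≡ ⟩
      at (f i′) (suc j)                                            ∎)
    where
    shift : p + b * p + j ≡ length (f i) + (b * p + j)
    shift = trans (+-assoc p (b * p) j) (cong (_+ (b * p + j)) (sym (length-f i)))

length-S : ∀ r p i → length (S r p i) ≡ p
length-S r p i = trans (length-map _ (upTo p)) (length-upTo p)

at-S : ∀ r p i {j} → j < p → at (S r p i) (suc j) ≡ rep r (i + j)
at-S r p i j<p = trans (cong (λ xs → at xs _) (map-upTo _ p)) (at-applyUpTo _ j<p)

at-concatS : ∀ {r p} .{{_ : NonZero p}} L {n} → n < length L * p →
             ∃ λ i → i ∈ L × at (concatS r p L) (suc n) ≡ rep r (i + n % p)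
at-concatS {r} {p} L {n} n<len
  with i , i∈L , at≡ ← at-concatMap-uniform (S r p) (length-S r p) L
                         (m<n*o⇒m/o<n n<len) (m%n<n n p) =
  i , i∈L , (begin
    at (concatS r p L) (suc n)                 ≡⟨ cong (at (concatS r p L) ∘ suc) n≡ ⟩
    at (concatS r p L) (suc (n / p * p + n % p)) ≡⟨ at≡ ⟩
    at (S r p i) (suc (n % p))                 ≡⟨ at-S r p i (m%n<n n p) ⟩
    rep r (i + n % p)                          ∎)
  where
  n≡ : n ≡ n / p * p + n % p
  n≡ = trans (m≡m%n+[m/n]*n n p) (+-comm (n % p) _)

Anchored : ℕ → ℕ → Set
Anchored p i = p ∣ i ∸ 1

rep-offset⇒anchored : ∀ {r p i j} .{{_ : NonZero p}} → 1 ≤ i → i ≤ r →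
                      j ≡ (rep r (i + j) ∸ 1) % p → Anchored p i
rep-offset⇒anchored {suc r} {i = suc i} _ i≤r = j≡[i+j]%r%p⇒p∣i i≤r

monoAP⇒anchored : ∀ {r p k L a d} → Prime p → p ≤ k → ¬ p ∣ d →
                  All (λ i → 1 ≤ i × i ≤ r) L → MonoAP (concatS r p L) k a d →
                  ∃ λ i → i ∈ L × Anchored p i
monoAP⇒anchored {k = zero} prime-p p≤0 =
  contradiction (n≤0⇒n≡0 p≤0) (≢-nonZero⁻¹ _ {{prime⇒nonZero prime-p}})
monoAP⇒anchored {r} {p} {suc k} {L} {suc A} {d} prime-p p≤k p∤d bounded (_ , _ , end≤ , mono) =
  anchored-at (residues-cover prime-p p∤d A j (m%n<n (c ∸ 1) p))
  where
  instance _ = prime⇒nonZero prime-p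
  T = concatS r p L
  c = at T (suc A)
  j = (c ∸ 1) % p
  term<len : ∀ {m} → m < p → A + m * d < length L * p
  term<len {m} m<p = ≤-trans (s≤s (+-monoʳ-≤ A (*-monoˡ-≤ d (s≤s⁻¹ (<-≤-trans m<p p≤k)))))
                       (≤-trans end≤ (≤-reflexive (length-concatMap-uniform (S r p) (length-S r p) L)))
  anchored-at : (∃ λ m → m < p × (A + m * d) % p ≡ j) → ∃ λ i → i ∈ L × Anchored p i
  anchored-at (m , m<p , hit)
    with i , i∈L , at≡ ← at-concatS {r} L (term<len m<p)
    with 1≤i , i≤r ← All.lookup bounded i∈L =
    i , i∈L , rep-offset⇒anchored 1≤i i≤r (begin
      j                                     ≡⟨ cong (λ x → (x ∸ 1) % p) (mono m (<-≤-trans m<p p≤k)) ⟨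
      (at T (suc (A + m * d)) ∸ 1) % p      ≡⟨ cong (λ x → (x ∸ 1) % p) at≡ ⟩
      (rep r (i + (A + m * d) % p) ∸ 1) % p ≡⟨ cong (λ x → (rep r (i + x) ∸ 1) % p) hit ⟩
      (rep r (i + j) ∸ 1) % p               ∎)

ceilDiv-suc : ∀ n p .{{_ : NonZero p}} → ceilDiv (suc n) p ≡ suc (n / p)
ceilDiv-suc n (suc q) = begin
  suc (n + q) / suc q                   ≡⟨ cong (_/ suc q) (+-suc n q) ⟨
  (n + suc q) / suc q                   ≡⟨ m/n≡1+[m∸n]/n (m≤n+m (suc q) n) ⟩
  suc ((n + suc q ∸ suc q) / suc q)     ≡⟨ cong (λ x → suc (x / suc q)) (m+n∸n≡m n (suc q)) ⟩
  suc (n / suc q)                       ∎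

ceilDiv-∣ : ∀ n p .{{_ : NonZero p}} → p ∣ n → ceilDiv n p ≡ n / p
ceilDiv-∣ n (suc q) p∣n = begin
  (n + q) / suc q         ≡⟨ +-distrib-/-∣ˡ q p∣n ⟩
  n / suc q + q / suc q   ≡⟨ cong (n / suc q +_) (m<n⇒m/n≡0 (n<1+n q)) ⟩
  n / suc q + 0           ≡⟨ +-identityʳ _ ⟩
  n / suc q               ∎

ceilDiv-∤ : ∀ n p .{{_ : NonZero p}} → ¬ p ∣ n → ceilDiv n p ≡ suc (n / p)
ceilDiv-∤ n p@(suc q) p∤n with n % p in rem≡
... | zero  = contradiction (m%n≡0⇒n∣m n p rem≡) p∤n
... | suc s = begin
  (n + q) / p                      ≡⟨ cong (λ x → (x + q) / p) (m≡m%n+[m/n]*n n p) ⟩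
  (n % p + t * p + q) / p          ≡⟨ cong (λ x → (x + t * p + q) / p) rem≡ ⟩
  (suc s + t * p + q) / p          ≡⟨ cong (_/ p) regroup ⟩
  (s + suc t * p) / p              ≡⟨ +-distrib-/-∣ʳ s (n∣m*n (suc t)) ⟩
  s / p + suc t * p / p            ≡⟨ cong₂ _+_ (m<n⇒m/n≡0 s<p) (m*n/n≡m (suc t) p) ⟩
  suc t                            ∎
  where
  t = n / p
  s<p : s < p
  s<p = <-trans (n<1+n s) (subst (_< p) rem≡ (m%n<n n p))
  regroup : suc s + t * p + q ≡ s + suc t * p
  regroup = begin
    suc (s + t * p + q)   ≡⟨ cong suc (+-assoc s (t * p) q) ⟩
    suc (s + (t * p + q)) ≡⟨ +-suc s (t * p + q) ⟨
    s + suc (t * p + q)   ≡⟨ cong (λ x → s + suc x) (+-comm (t * p) q) ⟩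
    s + suc t * p         ∎

unanchored : ℕ → ℕ → List ℕ
unanchored p zero    = []
unanchored p (suc n) with p ∣? n
... | yes _ = unanchored p n
... | no  _ = suc n ∷ unanchored p n

unanchored-bounded : ∀ p n → All (λ i → 1 ≤ i × i ≤ n) (unanchored p n)
unanchored-bounded p zero    = []
unanchored-bounded p (suc n) with p ∣? n
... | yes _ = All.map (λ (1≤i , i≤n) → 1≤i , m≤n⇒m≤1+n i≤n) (unanchored-bounded p n)
... | no  _ = (s≤s z≤n , ≤-refl)
            ∷ All.map (λ (1≤i , i≤n) → 1≤i , m≤n⇒m≤1+n i≤n) (unanchored-bounded p n)

unanchored-¬anchored : ∀ p n → All (¬_ ∘ Anchored p) (unanchored p n)
unanchored-¬anchored p zero    = []
unanchored-¬anchored p (suc n) with p ∣? n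
... | yes _   = unanchored-¬anchored p n
... | no  p∤n = p∤n ∷ unanchored-¬anchored p n

unanchored-unique : ∀ p n → Unique (unanchored p n)
unanchored-unique p zero    = []
unanchored-unique p (suc n) with p ∣? n
... | yes _ = unanchored-unique p n
... | no  _ = All.map (λ (_ , i≤n) 1+n≡i → 1+n≰n (subst (_≤ n) (sym 1+n≡i) i≤n))
                      (unanchored-bounded p n)
            ∷ unanchored-unique p n

length-unanchored : ∀ p n .{{_ : NonZero p}} → length (unanchored p n) + ceilDiv n p ≡ n
length-unanchored p@(suc q) zero = m<n⇒m/n≡0 (n<1+n q)
length-unanchored p (suc n) with p ∣? n
... | yes p∣n = begin
  length (unanchored p n) + ceilDiv (suc n) p   ≡⟨ cong (length (unanchored p n) +_) (ceilDiv-suc n p) ⟩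
  length (unanchored p n) + suc (n / p)         ≡⟨ +-suc _ _ ⟩
  suc (length (unanchored p n) + n / p)         ≡⟨ cong (λ x → suc (length (unanchored p n) + x)) (ceilDiv-∣ n p p∣n) ⟨
  suc (length (unanchored p n) + ceilDiv n p)   ≡⟨ cong suc (length-unanchored p n) ⟩
  suc n                                         ∎
... | no p∤n = cong suc (begin
  length (unanchored p n) + ceilDiv (suc n) p   ≡⟨ cong (length (unanchored p n) +_) (ceilDiv-suc n p) ⟩
  length (unanchored p n) + suc (n / p)         ≡⟨ cong (length (unanchored p n) +_) (ceilDiv-∤ n p p∤n) ⟨
  length (unanchored p n) + ceilDiv n p         ≡⟨ length-unanchored p n ⟩
  n                                             ∎)

lemma1 : (r k p : ℕ) → .{{NonZero r}} → 2 ≤ k →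
    Prime p → p ≤ k → (∀ q → Prime q → q ≤ k → q ≤ p) →
    Σ (List ℕ) λ L →
      All (λ i → 1 ≤ i × i ≤ r) L × Unique L × length L ≡ r ∸ ceilDiv r p ×
      (∀ L′ → L′ ↭ L → ∀ a d → MonoAP (concatS r p L′) k a d → p ∣ d)
lemma1 r k p _ prime-p p≤k _ =
  unanchored p r , unanchored-bounded p r , unanchored-unique p r , count , step-divisible
  where
  instance _ = prime⇒nonZero prime-p
  count : length (unanchored p r) ≡ r ∸ ceilDiv r p
  count = trans (sym (m+n∸n≡m _ (ceilDiv r p))) (cong (_∸ ceilDiv r p) (length-unanchored p r))
  step-divisible : ∀ L′ → L′ ↭ unanchored p r → ∀ a d → MonoAP (concatS r p L′) k a d → p ∣ d
  step-divisible L′ L′↭ a d ap with p ∣? d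
  ... | yes p∣d = p∣d
  ... | no  p∤d with i , i∈L′ , anchored ← monoAP⇒anchored prime-p p≤k p∤d
                      (All-resp-↭ (↭-sym L′↭) (unanchored-bounded p r)) ap =
    contradiction anchored (All.lookup (unanchored-¬anchored p r) (∈-resp-↭ L′↭ i∈L′))
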